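{- If a complete theory $T$ is $\mathrm{NBTP}$, then $T$ is $\mathrm{NATP}$.
   Context: $\varphi(x;y)$ has the antichain tree property ($\mathrm{ATP}$) if there is $(a_\eta)_{\eta\in 2^{<\omega}}$ such that for every antichain $X\subseteq 2^{<\omega}$ (pairwise $\trianglelefteq$-incomparable set), $\{\varphi(x;a_\eta):\eta\in X\}$ is consistent, and whenever $\eta\trianglelefteq\nu$ (and $\eta\neq\nu$), $\{\varphi(x;a_\eta),\varphi(x;a_\nu)\}$ is inconsistent; $T$ is $\mathrm{NATP}$ if no formula has $\mathrm{ATP}$. Let $\omega^{<\omega}_*$ be the nonempty finite sequences of naturals with initial-segment order $\trianglelefteq$. A left-leaning path is $(\lambda_n)$ with: if $\lambda_n=\eta^\frown\langle i\rangle$ then $\eta^\frown\langle j\rangle\vartriangleleft\lambda_{n+1}$ for some $j\le i$. A right-veering path is $(\rho_n)$ with: if $\rho_n=\eta^\frown\langle i\rangle$ then $\eta^\frown\langle j\rangle\trianglelefteq\rho_{n+1}$ for some $j>i$. $\varphi(x;y)$ has $k$-$\mathrm{BTP}$ if there is $(a_\eta)_{\eta\in\omega^{<\omega}_*}$ with $\{\varphi(x;a_{\lambda_n})\}$ consistent along every left-leaning path and $\{\varphi(x;a_{\rho_n})\}$ $k$-inconsistent along every right-veering path; $T$ is $\mathrm{NBTP}$ if no formula has $k$-$\mathrm{BTP}$ for any $k<\omega$. -}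

module Defs where

open import Data.Nat using (ℕ; zero; suc; _+_; _≤_; _<_)
open import Data.Fin using (Fin)
open import Data.Bool using (Bool)
open import Data.List using (List; _++_; [_])
open import Data.List.Relation.Unary.All using (All)
open import Data.Product using (Σ; ∃; _×_; proj₁; proj₂)
open import Data.Sum using (_⊎_)
open import Data.Empty using (⊥)
open import Relation.Nullary using (¬_)
open import Relation.Binary.PropositionalEquality using (_≡_; _≢_)
open import Function using (_∘_)
open import Function.Definitions using (Injective)
import Data.Vec.Functional as VF

record Language : Set₁ where
  field
    Func : ℕ → Set
    Rel  : ℕ → Set

module _ (L : Language) where
  open Language L

  data Term (n : ℕ) : Set where
    var  : Fin n → Term n
    func : ∀ {k} → Func k → (Fin k → Term n) → Term n

  -- formulas with free variables among Fin n (de Bruijn: a quantifier binds index zero)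
  data Formula (n : ℕ) : Set where
    ⊥ᶠ   : Formula n
    _≐_  : Term n → Term n → Formula n
    rel  : ∀ {k} → Rel k → (Fin k → Term n) → Formula n
    ¬ᶠ_  : Formula n → Formula n
    _∧ᶠ_ : Formula n → Formula n → Formula n
    _∨ᶠ_ : Formula n → Formula n → Formula n
    _⇒ᶠ_ : Formula n → Formula n → Formula n
    ∀ᶠ_  : Formula (suc n) → Formula n
    ∃ᶠ_  : Formula (suc n) → Formula n

  Sentence : Set
  Sentence = Formula 0

  record Structure : Set₁ where
    field
      Carrier : Set
      funᴹ    : ∀ {k} → Func k → (Fin k → Carrier) → Carrier
      relᴹ    : ∀ {k} → Rel k → (Fin k → Carrier) → Set

  module _ (M : Structure) where
    open Structure M

    eval : ∀ {n} → (Fin n → Carrier) → Term n → Carrier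
    eval e (var i)     = e i
    eval e (func f ts) = funᴹ f (λ i → eval e (ts i))

    Sat : ∀ {n} → Formula n → (Fin n → Carrier) → Set
    Sat ⊥ᶠ          e = ⊥
    Sat (t ≐ u)     e = eval e t ≡ eval e u
    Sat (rel R ts)  e = relᴹ R (λ i → eval e (ts i))
    Sat (¬ᶠ φ)      e = ¬ Sat φ e
    Sat (φ ∧ᶠ ψ)    e = Sat φ e × Sat ψ e
    Sat (φ ∨ᶠ ψ)    e = Sat φ e ⊎ Sat ψ e
    Sat (φ ⇒ᶠ ψ)    e = Sat φ e → Sat ψ e
    Sat (∀ᶠ φ)      e = (a : Carrier) → Sat φ (a VF.∷ e)
    Sat (∃ᶠ φ)      e = Σ Carrier λ a → Sat φ (a VF.∷ e)

  Theory : Set₁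
  Theory = Sentence → Set

  IsModel : Theory → Structure → Set
  IsModel T M = ∀ σ → T σ → Sat M σ (λ ())

  Entails : Theory → Sentence → Set₁
  Entails T σ = (M : Structure) → IsModel T M → Sat M σ (λ ())

  Complete : Theory → Set₁
  Complete T = (Σ Structure (IsModel T)) × (∀ σ → Entails T σ ⊎ Entails T (¬ᶠ σ))

  module _ (M : Structure) {n m : ℕ} (φ : Formula (n + m)) where
    open Structure M

    Realizes : (Fin n → Carrier) → (Fin m → Carrier) → Set
    Realizes c b = Sat M φ (c VF.++ b)

    -- {φ(x;b_i) : i ∈ I} is consistent (with the elementary diagram of M),
    -- i.e. finitely satisfiable in M
    Consistent : {I : Set} → (I → Fin m → Carrier) → Set
    Consistent {I} b = (F : List I) → Σ (Fin n → Carrier) λ c → All (λ i → Realizes c (b i)) F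

    KInconsistent : ℕ → {I : Set} → (I → Fin m → Carrier) → Set
    KInconsistent k {I} b =
      (s : Fin k → I) → Injective _≡_ _≡_ s →
      ¬ (Σ (Fin n → Carrier) λ c → (j : Fin k) → Realizes c (b (s j)))

_⊴_ : {A : Set} → List A → List A → Set
_⊴_ {A} η ν = Σ (List A) λ ζ → η ++ ζ ≡ ν

_◁_ : {A : Set} → List A → List A → Set
η ◁ ν = η ⊴ ν × η ≢ ν

Antichain : (List Bool → Set) → Set
Antichain X = ∀ η ν → X η → X ν → η ≢ ν → ¬ (η ⊴ ν)

-- ω^{<ω}_*: nonempty finite sequences of naturals, the node (η , i) being η⌢⟨i⟩
Node : Set
Node = List ℕ × ℕ

⌊_⌋ : Node → List ℕ
⌊ ηi ⌋ = proj₁ ηi ++ [ proj₂ ηi ]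

LeftLeaning : (ℕ → Node) → Set
LeftLeaning lam = ∀ k → Σ ℕ λ j → (j ≤ proj₂ (lam k)) × ((proj₁ (lam k) ++ [ j ]) ◁ ⌊ lam (suc k) ⌋)

RightVeering : (ℕ → Node) → Set
RightVeering ρ = ∀ k → Σ ℕ λ j → (proj₂ (ρ k) < j) × ((proj₁ (ρ k) ++ [ j ]) ⊴ ⌊ ρ (suc k) ⌋)

module _ {L : Language} where

  ATPIn : (M : Structure L) {n m : ℕ} → Formula L (n + m) → Set₁
  ATPIn M {n} {m} φ =
    Σ (List Bool → Fin m → Structure.Carrier M) λ a →
      (∀ (X : List Bool → Set) → Antichain X →
         Consistent L M φ {Σ (List Bool) X} (λ p → a (proj₁ p)))
    × (∀ η ν → η ◁ ν →
         ¬ (Σ (Fin n → Structure.Carrier M) λ c →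
              Realizes L M φ c (a η) × Realizes L M φ c (a ν)))

  BTPIn : (M : Structure L) {n m : ℕ} → Formula L (n + m) → ℕ → Set
  BTPIn M {n} {m} φ k =
    Σ (Node → Fin m → Structure.Carrier M) λ a →
      (∀ (lam : ℕ → Node) → LeftLeaning lam → Consistent L M φ (a ∘ lam))
    × (∀ (ρ : ℕ → Node) → RightVeering ρ → KInconsistent L M φ k (a ∘ ρ))

  -- φ has ATP (resp. k-BTP) modulo T: witnessed in some model of T
  -- (equivalently, in the monster model of a complete T)
  HasATP : Theory L → {n m : ℕ} → Formula L (n + m) → Set₁
  HasATP T {n} {m} φ = Σ (Structure L) λ M → IsModel L T M × ATPIn M {n} {m} φ

  HasBTP : Theory L → {n m : ℕ} → Formula L (n + m) → ℕ → Set₁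
  HasBTP T {n} {m} φ k = Σ (Structure L) λ M → IsModel L T M × BTPIn M {n} {m} φ k

  NATP : Theory L → Set₁
  NATP T = ∀ n m (φ : Formula L (n + m)) → ¬ HasATP T {n} {m} φ

  NBTP : Theory L → Set₁
  NBTP T = ∀ n m (φ : Formula L (n + m)) (k : ℕ) → ¬ HasBTP T {n} {m} φ k

{-# OPTIONS --safe #-}
module Submission where

-- Embed ω^{<ω}_* into 2^{<ω} by  η⌢⟨i⟩ ↦ 1^{η₀}0 ⋯ 1^{η_{k-1}}0 1^{i+1}.  The images of the
-- siblings η⌢⟨i⟩ form a strict ⊴-chain in i, and everything at or below η⌢⟨j⟩ lands above
-- 1^{η₀}0 ⋯ 1^{η_{k-1}}0 1^j 0, which is ⊴-incomparable with the image of η⌢⟨i⟩ whenever j ≤ i.  Hence a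
-- right-veering path becomes a strict chain and a left-leaning path an antichain, so an ATP
-- witness (a_ν) for φ, composed with the embedding, is a 2-BTP witness for φ.

open import Defs
open import Data.Nat using (ℕ; zero; suc; _+_; _≤_; _<_; _≤′_; ≤′-refl; ≤′-step; z≤n; s≤s)
open import Data.Nat.Properties using (<-cmp; ≤⇒≤′)
open import Data.Fin using (Fin) renaming (zero to 0F; suc to sucF)
open import Data.Bool using (Bool; true; false)
open import Data.List using (List; []; _∷_; _++_; [_]; _∷ʳ_; replicate; concatMap; map)
open import Data.List.Properties
  using (∷-injective; ∷ʳ-injective; ++-assoc; ++-identityʳ; ++-cancelˡ; ++-conicalˡ;
         ++-identityʳ-unique; concatMap-++)
open import Data.List.Relation.Unary.All.Properties using (map⁻)
open import Data.Product using (∃; _×_; _,_; proj₁; proj₂)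
open import Data.Sum using (_⊎_; inj₁; inj₂) renaming (map to ⊎-map)
open import Data.Empty using (⊥-elim)
open import Function using (_∘_; case_of_)
open import Relation.Nullary using (¬_)
open import Relation.Binary.Definitions using (Reflexive; Transitive; tri<; tri≈; tri>)
open import Relation.Binary.PropositionalEquality using (_≡_; refl; sym; trans; cong; subst)

module _ {A : Set} {R : A → A → Set} (R-refl : Reflexive R) (R-trans : Transitive R) where

  step-monotone : (s : ℕ → A) → (∀ k → R (s k) (s (suc k))) → ∀ {m n} → m ≤′ n → R (s m) (s n)
  step-monotone s step ≤′-refl     = R-refl
  step-monotone s step (≤′-step p) = R-trans (step-monotone s step p) (step _)

module _ {A : Set} where

  _⊏_ : List A → List A → Set
  η ⊏ ν = ∃ λ x → ∃ λ ζ → η ++ x ∷ ζ ≡ ν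

  Incomparable : List A → List A → Set
  Incomparable η ν = ¬ η ⊴ ν × ¬ ν ⊴ η

  ⊴-refl : ∀ {η : List A} → η ⊴ η
  ⊴-refl {η} = [] , ++-identityʳ η

  ⊴-trans : ∀ {η ν μ : List A} → η ⊴ ν → ν ⊴ μ → η ⊴ μ
  ⊴-trans {η} (ζ , refl) (ξ , refl) = ζ ++ ξ , sym (++-assoc η ζ ξ)

  ⊴-++ : (η ζ : List A) → η ⊴ (η ++ ζ)
  ⊴-++ η ζ = ζ , refl

  ⊴-++ˡ : (p : List A) {η ν : List A} → η ⊴ ν → (p ++ η) ⊴ (p ++ ν)
  ⊴-++ˡ p {η} (ζ , refl) = ζ , ++-assoc p η ζ

  ⊴-cancelˡ : (p : List A) {η ν : List A} → (p ++ η) ⊴ (p ++ ν) → η ⊴ ν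
  ⊴-cancelˡ p {η} {ν} (ζ , e) = ζ , ++-cancelˡ p (η ++ ζ) ν (trans (sym (++-assoc p η ζ)) e)

  ⊴-comparable : ∀ {η ν μ : List A} → η ⊴ μ → ν ⊴ μ → η ⊴ ν ⊎ ν ⊴ η
  ⊴-comparable {[]}    {ν}              _ _ = inj₁ (ν , refl)
  ⊴-comparable {x ∷ η} {[]}             _ _ = inj₂ (x ∷ η , refl)
  ⊴-comparable {x ∷ η} {y ∷ ν} {[]}     (_ , ()) _
  ⊴-comparable {x ∷ η} {y ∷ ν} {z ∷ μ} (ζ , e) (ξ , e′)
    with refl , e₁ ← ∷-injective e | refl , e₂ ← ∷-injective e′ =
    ⊎-map (⊴-++ˡ [ x ]) (⊴-++ˡ [ x ]) (⊴-comparable (ζ , e₁) (ξ , e₂))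

  ⊴-∷ʳ : (η μ : List A) {l : A} → η ⊴ (μ ∷ʳ l) → η ≡ μ ∷ʳ l ⊎ η ⊴ μ
  ⊴-∷ʳ []      μ       _       = inj₂ (μ , refl)
  ⊴-∷ʳ (x ∷ η) []      (ζ , e)
    with refl , e′ ← ∷-injective e
    with refl ← ++-conicalˡ η ζ e′ = inj₁ refl
  ⊴-∷ʳ (x ∷ η) (y ∷ μ) (ζ , e)
    with refl , e′ ← ∷-injective e = ⊎-map (cong (x ∷_)) (⊴-++ˡ [ x ]) (⊴-∷ʳ η μ (ζ , e′))

  ◁-∷ʳ⇒⊴ : ∀ {η μ : List A} {l : A} → η ◁ (μ ∷ʳ l) → η ⊴ μ
  ◁-∷ʳ⇒⊴ {η} {μ} (p , η≢μl) with ⊴-∷ʳ η μ p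
  ... | inj₁ η≡μl = ⊥-elim (η≢μl η≡μl)
  ... | inj₂ η⊴μ  = η⊴μ

  ⊴-monotone : (s : ℕ → List A) → (∀ k → s k ⊴ s (suc k)) → ∀ {m n} → m ≤′ n → s m ⊴ s n
  ⊴-monotone = step-monotone {R = _⊴_} ⊴-refl ⊴-trans

  ⊏⇒⊴ : ∀ {η ν : List A} → η ⊏ ν → η ⊴ ν
  ⊏⇒⊴ (x , ζ , e) = x ∷ ζ , e

  ⊏⇒◁ : ∀ {η ν : List A} → η ⊏ ν → η ◁ ν
  ⊏⇒◁ {η} p@(x , ζ , e) = ⊏⇒⊴ p , λ { refl → case ++-identityʳ-unique η (sym e) of λ () }

  ⊏-⊴-trans : ∀ {η ν μ : List A} → η ⊏ ν → ν ⊴ μ → η ⊏ μ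
  ⊏-⊴-trans {η} (x , ζ , refl) (ξ , refl) = x , ζ ++ ξ , sym (++-assoc η (x ∷ ζ) ξ)

  ⊴-⊏-trans : ∀ {η ν μ : List A} → η ⊴ ν → ν ⊏ μ → η ⊏ μ
  ⊴-⊏-trans {η} ([]    , refl) (x , ξ , refl) = x , ξ , cong (_++ x ∷ ξ) (sym (++-identityʳ η))
  ⊴-⊏-trans {η} (y ∷ ζ , refl) (x , ξ , refl) = y , ζ ++ x ∷ ξ , sym (++-assoc η (y ∷ ζ) (x ∷ ξ))

  ⊏-++ˡ : (p : List A) {η ν : List A} → η ⊏ ν → (p ++ η) ⊏ (p ++ ν)
  ⊏-++ˡ p {η} (x , ζ , refl) = x , ζ , ++-assoc p η (x ∷ ζ)

  incomparable-++ˡ : (p : List A) {η ν : List A} → Incomparable η ν → Incomparable (p ++ η) (p ++ ν)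
  incomparable-++ˡ p (η⋬ν , ν⋬η) = η⋬ν ∘ ⊴-cancelˡ p , ν⋬η ∘ ⊴-cancelˡ p

  incomparable-extendʳ : ∀ {η ν μ : List A} → Incomparable η ν → ν ⊴ μ → Incomparable η μ
  incomparable-extendʳ (η⋬ν , ν⋬η) ν⊴μ =
    (λ η⊴μ → case ⊴-comparable η⊴μ ν⊴μ of λ { (inj₁ η⊴ν) → η⋬ν η⊴ν ; (inj₂ ν⊴η) → ν⋬η ν⊴η }) ,
    (λ μ⊴η → ν⋬η (⊴-trans ν⊴μ μ⊴η))

ones : ℕ → List Bool
ones n = replicate n true

block : ℕ → List Bool
block j = ones j ∷ʳ false

ones-⊴ : ∀ {i j} → i ≤ j → ones i ⊴ ones j
ones-⊴ {j = j} z≤n = ones j , refl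
ones-⊴ (s≤s i≤j)   = ⊴-++ˡ [ true ] (ones-⊴ i≤j)

ones-⊏ : ∀ {i j} → i < j → ones i ⊏ ones j
ones-⊏ {zero}  {suc j} _         = true , ones j , refl
ones-⊏ {suc i}         (s≤s i<j) = ⊏-++ˡ [ true ] (ones-⊏ i<j)

ones-⊏-block : ∀ {i j} → i < j → ones (suc i) ⊏ block j
ones-⊏-block i<j = ⊴-⊏-trans (ones-⊴ i<j) (false , [] , refl)

ones-incomparable-block : ∀ {i j} → j ≤ i → Incomparable (ones (suc i)) (block j)
ones-incomparable-block z≤n       = (λ { (_ , ()) }) , (λ { (_ , ()) })
ones-incomparable-block (s≤s j≤i) = incomparable-++ˡ [ true ] (ones-incomparable-block j≤i)

code : List ℕ → List Bool
code = concatMap block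

code-∷ʳ : (η : List ℕ) (j : ℕ) → code (η ∷ʳ j) ≡ code η ++ block j
code-∷ʳ η j = trans (concatMap-++ block η [ j ]) (cong (code η ++_) (++-identityʳ (block j)))

code-mono : ∀ {η ν : List ℕ} → η ⊴ ν → code η ⊴ code ν
code-mono {η} (ζ , refl) = code ζ , sym (concatMap-++ block η ζ)

embed : Node → List Bool
embed (η , i) = code η ++ ones (suc i)

block-⊴-embed : ∀ {η μ : List ℕ} {j l : ℕ} → (η ∷ʳ j) ⊴ μ → (code η ++ block j) ⊴ embed (μ , l)
block-⊴-embed {η} {μ} {j} p = ⊴-trans (subst (_⊴ code μ) (code-∷ʳ η j) (code-mono p)) (⊴-++ (code μ) _)

veer-⊏ : ∀ {η μ : List ℕ} {i j l : ℕ} → i < j → (η ∷ʳ j) ⊴ (μ ∷ʳ l) → embed (η , i) ⊏ embed (μ , l)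
veer-⊏ {η} {μ = μ} i<j p with ⊴-∷ʳ (η ∷ʳ _) μ p
... | inj₁ e with refl , refl ← ∷ʳ-injective η μ e = ⊏-++ˡ (code η) (ones-⊏ (s≤s i<j))
... | inj₂ q = ⊏-⊴-trans (⊏-++ˡ (code η) (ones-⊏-block i<j)) (block-⊴-embed q)

module _ {ρ : ℕ → Node} (rv : RightVeering ρ) where

  rightVeering-step : ∀ k → embed (ρ k) ⊏ embed (ρ (suc k))
  rightVeering-step k = let j , i<j , p = rv k in veer-⊏ i<j p

  rightVeering-⊏ : ∀ {t t′} → t < t′ → embed (ρ t) ⊏ embed (ρ t′)
  rightVeering-⊏ {t} t<t′ =
    ⊏-⊴-trans (rightVeering-step t)
      (⊴-monotone (embed ∘ ρ) (⊏⇒⊴ ∘ rightVeering-step) (≤⇒≤′ t<t′))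

module _ {lam : ℕ → Node} (ll : LeftLeaning lam) where

  leftLeaning-stem : ∀ k → proj₁ (lam k) ⊴ proj₁ (lam (suc k))
  leftLeaning-stem k = let j , _ , p = ll k in ⊴-trans (⊴-++ _ [ j ]) (◁-∷ʳ⇒⊴ p)

  leftLeaning-incomparable : ∀ {t t′} → t < t′ → Incomparable (embed (lam t)) (embed (lam t′))
  leftLeaning-incomparable {t} {t′} t<t′ =
    let j , j≤i , p = ll t
        η⌢j⊴stem = ⊴-trans (◁-∷ʳ⇒⊴ p)
                     (⊴-monotone (proj₁ ∘ lam) leftLeaning-stem (≤⇒≤′ t<t′))
    in incomparable-extendʳ (incomparable-++ˡ (code (proj₁ (lam t))) (ones-incomparable-block j≤i))
                            (block-⊴-embed {μ = proj₁ (lam t′)} η⌢j⊴stem)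

image-antichain : (e : ℕ → List Bool) → (∀ {t t′} → t < t′ → Incomparable (e t) (e t′)) →
                  Antichain (λ ν → ∃ λ t → e t ≡ ν)
image-antichain e incomparable _ _ (t , refl) (t′ , refl) e≢ with <-cmp t t′
... | tri< t<t′ _ _ = proj₁ (incomparable t<t′)
... | tri≈ _ refl _ = ⊥-elim (e≢ refl)
... | tri> _ _ t′<t = proj₂ (incomparable t′<t)

module _ {L : Language} (M : Structure L) {n m : ℕ} (φ : Formula L (n + m)) where
  open Structure M

  consistent-reindex : ∀ {I J : Set} {b : J → Fin m → Carrier} →
                       Consistent L M φ b → (r : I → J) → Consistent L M φ (b ∘ r)
  consistent-reindex consistent r F = let c , sat = consistent (map r F) in c , map⁻ sat

  ordered-inconsistent⇒2-inconsistent :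
    {b : ℕ → Fin m → Carrier} →
    (∀ {t t′} → t < t′ → ¬ ∃ λ c → Realizes L M φ c (b t) × Realizes L M φ c (b t′)) →
    KInconsistent L M φ 2 b
  ordered-inconsistent⇒2-inconsistent inconsistent s s-inj (c , sat) with <-cmp (s 0F) (s (sucF 0F))
  ... | tri< lt _ _ = inconsistent lt (c , sat 0F , sat (sucF 0F))
  ... | tri≈ _ eq _ = case s-inj eq of λ ()
  ... | tri> _ _ gt = inconsistent gt (c , sat (sucF 0F) , sat 0F)

proposition5p6 : (L : Language) (T : Theory L) → Complete L T → NBTP T → NATP T
proposition5p6 L T _ nbtp n m φ (M , M⊨T , a , antichain-consistent , chain-inconsistent) =
  nbtp n m φ 2 (M , M⊨T , a ∘ embed , left , right)
  where
  left : ∀ lam → LeftLeaning lam → Consistent L M φ (a ∘ embed ∘ lam)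
  left lam ll =
    consistent-reindex M φ
      (antichain-consistent _ (image-antichain (embed ∘ lam) (leftLeaning-incomparable ll)))
      (λ t → embed (lam t) , t , refl)

  right : ∀ ρ → RightVeering ρ → KInconsistent L M φ 2 (a ∘ embed ∘ ρ)
  right ρ rv = ordered-inconsistent⇒2-inconsistent M φ
                 (λ t<t′ → chain-inconsistent _ _ (⊏⇒◁ (rightVeering-⊏ rv t<t′)))
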